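{- Let $G$ be a $4$-regular graph on $n\ge 7$ vertices and let $G'$ be the labeled complete graph on $V(G)$ whose $+$ edges are exactly the edges of $G$. Let $H$ be the labeled complete graph obtained from $G'$ by adding, for every $3$-subset $\{u,v,w\}\subseteq V(G')$, a new set $C_{uvw}$ of $7$ vertices such that all edges within $C_{uvw}$ are $+$, all edges from $C_{uvw}$ to $u,v,w$ are $+$, and all other edges incident to $C_{uvw}$ are $-$. Assign tolerances $t_u=7\left(\binom{n-1}{2}-1\right)+2$ to each $u\in V(G')$ and $t_v=3$ to each added vertex $v$. Then $H$ has a $t$-perfect clustering if and only if $V(G)$ can be partitioned into sets each of which induces a triangle in $G$.
   Context: A clustering is a partition of the vertex set. Given a clustering, an error is a $+$ edge between different clusters or a $-$ edge within a cluster. A clustering is $t$-perfect if each vertex $v$ is incident to at most $t_v$ errors. -}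

module Defs where

open import Data.Bool using (Bool; true; false; not; _∧_; _∨_; if_then_else_; T)
open import Data.Nat using (ℕ; _≤_; _∸_; _*_; _+_)
open import Data.Nat.Combinatorics using (_C_)
import Data.Nat as ℕ
open import Data.Fin using (Fin; _<_)
open import Data.Fin.Properties using (_<?_; _≟_)
open import Data.List using (List; []; _∷_; _++_; map; concatMap; allFin; length; filterᵇ)
open import Data.Product using (Σ; Σ-syntax; _×_; _,_; ∃)
open import Data.Sum using (_⊎_; inj₁; inj₂)
open import Relation.Nullary using (yes; no; ¬_)
open import Relation.Nullary.Decidable using (⌊_⌋)
open import Relation.Binary.PropositionalEquality using (_≡_)

record Graph (n : ℕ) : Set where
  field
    adj   : Fin n → Fin n → Bool
    sym   : ∀ u v → adj u v ≡ adj v u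
    irrefl : ∀ v → adj v v ≡ false
open Graph public

count : {A : Set} → (A → Bool) → List A → ℕ
count p xs = length (filterᵇ p xs)

deg : {n : ℕ} → Graph n → Fin n → ℕ
deg {n} G v = count (adj G v) (allFin n)

IsRegular : {n : ℕ} → ℕ → Graph n → Set
IsRegular k G = ∀ v → deg G v ≡ k

-- 3-subsets {a,b,c} of Fin n, represented canonically as a < b < c
Triple : ℕ → Set
Triple n = Σ[ a ∈ Fin n ] Σ[ b ∈ Fin n ] Σ[ c ∈ Fin n ] (a < b × b < c)

tripleAt : {n : ℕ} → Fin n → Fin n → Fin n → List (Triple n)
tripleAt a b c with a <? b | b <? c
... | yes p | yes q = (a , b , c , p , q) ∷ []
... | _     | _     = []

allTriples : (n : ℕ) → List (Triple n)
allTriples n = concatMap (λ a → concatMap (λ b → concatMap (λ c → tripleAt a b c) (allFin n)) (allFin n)) (allFin n)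

-- vertices of H: original vertices, plus for each 3-subset t a block C_t of 7 new vertices
HVertex : ℕ → Set
HVertex n = Fin n ⊎ (Triple n × Fin 7)

allHVertices : (n : ℕ) → List (HVertex n)
allHVertices n = map inj₁ (allFin n)
              ++ concatMap (λ t → map (λ i → inj₂ (t , i)) (allFin 7)) (allTriples n)

eqF : {n : ℕ} → Fin n → Fin n → Bool
eqF x y = ⌊ x ≟ y ⌋

sameTriple : {n : ℕ} → Triple n → Triple n → Bool
sameTriple (a , b , c , _) (a' , b' , c' , _) = eqF a a' ∧ eqF b b' ∧ eqF c c'

-- equality of vertices of H (determined by their data; the order proofs are irrelevant)
sameVertex : {n : ℕ} → HVertex n → HVertex n → Bool
sameVertex (inj₁ u) (inj₁ v) = eqF u v
sameVertex (inj₁ _) (inj₂ _) = false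
sameVertex (inj₂ _) (inj₁ _) = false
sameVertex (inj₂ (t , i)) (inj₂ (s , j)) = sameTriple t s ∧ eqF i j

inTriple : {n : ℕ} → Fin n → Triple n → Bool
inTriple u (a , b , c , _) = eqF u a ∨ eqF u b ∨ eqF u c

-- the labels of H: true = + edge, false = − edge
Hplus : {n : ℕ} → Graph n → HVertex n → HVertex n → Bool
Hplus G (inj₁ u) (inj₁ v) = adj G u v
Hplus G (inj₁ u) (inj₂ (t , _)) = inTriple u t
Hplus G (inj₂ (t , _)) (inj₁ u) = inTriple u t
Hplus G (inj₂ (t , _)) (inj₂ (s , _)) = sameTriple t s

-- A clustering (partition of the vertex set) is given by a cluster-label map;
-- two vertices lie in the same cluster iff they have the same label.
Clustering : ℕ → Set
Clustering n = HVertex n → ℕ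

isError : {n : ℕ} → Graph n → Clustering n → HVertex n → HVertex n → Bool
isError G cl x y with Hplus G x y | ⌊ cl x ℕ.≟ cl y ⌋
... | true  | same = not same
... | false | same = same

errorsAt : {n : ℕ} → Graph n → Clustering n → HVertex n → ℕ
errorsAt {n} G cl v = count (λ w → not (sameVertex v w) ∧ isError G cl v w) (allHVertices n)

tolerance : {n : ℕ} → HVertex n → ℕ
tolerance {n} (inj₁ _) = 7 * (((n ∸ 1) C 2) ∸ 1) + 2
tolerance (inj₂ _) = 3

IsTPerfect : {n : ℕ} → Graph n → Clustering n → Set
IsTPerfect G cl = ∀ v → errorsAt G cl v ≤ tolerance v

HasTPerfectClustering : {n : ℕ} → Graph n → Set
HasTPerfectClustering {n} G = Σ (Clustering n) (IsTPerfect G)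

-- V(G) can be partitioned into sets each inducing a triangle in G:
-- a labeling p of the vertices such that every class has exactly 3 elements
-- and any two distinct vertices in the same class are adjacent.
HasTrianglePartition : {n : ℕ} → Graph n → Set
HasTrianglePartition {n} G =
  Σ (Fin n → ℕ) λ p →
    (∀ v → count (λ w → ⌊ p w ℕ.≟ p v ⌋) (allFin n) ≡ 3)
    × (∀ v w → p v ≡ p w → ¬ (v ≡ w) → adj G v w ≡ true)

-- (⇐, module Backward) Put every triangle into one cluster together with the block of its own
-- 3-subset, and give every other block a private cluster.  An original vertex then errs on its two
-- neighbours outside its triangle and on the 7 vertices of each of the other ((n-1) choose 2) - 1
-- blocks through it; a block vertex errs only on the (at most 3) original vertices of its 3-subset.
--
-- (⇒, module Forward) Tolerance 3 forces every block into a single cluster and distinct blocks into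
-- distinct clusters.  An original vertex u lies in ((n-1) choose 2) 3-subsets, each of whose blocks
-- costs 7 errors unless it shares u's cluster; the tolerance of u forces exactly one of them, its
-- own triple, into u's cluster and leaves at most 2 errors among original vertices.  So the cluster
-- of u inside V(G) lies in its own triple, and degree 4 against at most 2 errors makes it a triangle
-- of G through u.

module Submission where

open import Defs hiding (sym)
open import Data.Bool using (Bool; true; false; not; _∧_; _∨_; _xor_; if_then_else_)
open import Data.Bool.Properties
  using (∧-conicalˡ; ∧-conicalʳ; ∧-zeroʳ; ∧-identityʳ; ∧-assoc; ∧-comm; ∨-zeroʳ; T-≡)
open import Data.Nat using (ℕ; zero; suc; _+_; _*_; _∸_; _≤_; _<_; z≤n; s≤s; _≡ᵇ_; _<ᵇ_)
import Data.Nat as ℕ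
open import Data.Nat.Properties hiding (_≟_; _<?_)
open import Data.Nat.Combinatorics using (_C_; nCk+nC[k+1]≡[n+1]C[k+1]; nC1≡n)
open import Data.Fin using (Fin; toℕ; combine) renaming (zero to fzero; suc to fsuc)
import Data.Fin as Fin
import Data.Fin.Properties as Finₚ
open import Data.Fin.Properties using (_≟_; _<?_; toℕ<n; toℕ-injective; combine-injective)
open import Data.List using (List; []; _∷_; _++_; map; concatMap; allFin; tabulate)
open import Data.List.Membership.Propositional using (_∈_; lose)
open import Data.List.Membership.Propositional.Properties using (∈-concatMap⁺; ∈-allFin)
open import Data.List.Relation.Unary.Any using (here; there)
open import Data.Product using (Σ; _×_; _,_; proj₁; proj₂)
open import Data.Sum using (_⊎_; inj₁; inj₂)
open import Data.Empty using (⊥; ⊥-elim)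
open import Function.Bundles using (_⇔_; mk⇔; Equivalence)
open import Relation.Binary.Definitions using (tri<; tri≈; tri>)
open import Relation.Binary.PropositionalEquality
  using (_≡_; refl; sym; trans; cong; cong₂; subst; module ≡-Reasoning)
open import Relation.Nullary using (Dec; yes; no; ¬_; contradiction)
open import Relation.Nullary.Decidable using (⌊_⌋; T?; ⌊⌋-map′; from-no; from-yes)
open import Algebra.Properties.CommutativeSemigroup +-commutativeSemigroup using (interchange)

private variable
  A B : Set
  n : ℕ

⌊⌋-true : {P : Set} (d : Dec P) → P → ⌊ d ⌋ ≡ true
⌊⌋-true (yes _) _ = refl
⌊⌋-true (no ¬p) p = ⊥-elim (¬p p)

⌊⌋-false : {P : Set} (d : Dec P) → ¬ P → ⌊ d ⌋ ≡ false
⌊⌋-false (yes p) ¬p = ⊥-elim (¬p p)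
⌊⌋-false (no _) _ = refl

⌊⌋-sound : {P : Set} (d : Dec P) → ⌊ d ⌋ ≡ true → P
⌊⌋-sound (yes p) _ = p

not-both : {b : Bool} → b ≡ true → not b ≡ true → ⊥
not-both refl ()

∧-intro : {a b : Bool} → a ≡ true → b ≡ true → (a ∧ b) ≡ true
∧-intro refl refl = refl

not-intro : {b : Bool} → ¬ b ≡ true → not b ≡ true
not-intro {true} ¬b = ⊥-elim (¬b refl)
not-intro {false} _ = refl

xor-cases : {a b : Bool} → (a xor b) ≡ true → (a ≡ true × b ≡ false) ⊎ (a ≡ false × b ≡ true)
xor-cases {true} {false} _ = inj₁ (refl , refl)
xor-cases {false} {true} _ = inj₂ (refl , refl)

𝟙 : Bool → ℕ
𝟙 true = 1
𝟙 false = 0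

sumOver : List A → (A → ℕ) → ℕ
sumOver [] f = 0
sumOver (x ∷ xs) f = f x + sumOver xs f

sumOver-cong : (xs : List A) {f g : A → ℕ} → (∀ x → f x ≡ g x) → sumOver xs f ≡ sumOver xs g
sumOver-cong [] f≗g = refl
sumOver-cong (x ∷ xs) f≗g = cong₂ _+_ (f≗g x) (sumOver-cong xs f≗g)

sumOver-mono : (xs : List A) {f g : A → ℕ} → (∀ x → f x ≤ g x) → sumOver xs f ≤ sumOver xs g
sumOver-mono [] f≤g = z≤n
sumOver-mono (x ∷ xs) f≤g = +-mono-≤ (f≤g x) (sumOver-mono xs f≤g)

sumOver-+ : (xs : List A) (f g : A → ℕ) → sumOver xs (λ x → f x + g x) ≡ sumOver xs f + sumOver xs g
sumOver-+ [] f g = refl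
sumOver-+ (x ∷ xs) f g = trans (cong (f x + g x +_) (sumOver-+ xs f g)) (interchange (f x) (g x) _ _)

sumOver-* : (xs : List A) (k : ℕ) (f : A → ℕ) → sumOver xs (λ x → k * f x) ≡ k * sumOver xs f
sumOver-* [] k f = sym (*-zeroʳ k)
sumOver-* (x ∷ xs) k f = trans (cong (k * f x +_) (sumOver-* xs k f)) (sym (*-distribˡ-+ k (f x) _))

sumOver-++ : (xs ys : List A) (f : A → ℕ) → sumOver (xs ++ ys) f ≡ sumOver xs f + sumOver ys f
sumOver-++ [] ys f = refl
sumOver-++ (x ∷ xs) ys f = trans (cong (f x +_) (sumOver-++ xs ys f)) (sym (+-assoc (f x) _ _))

sumOver-map : (h : A → B) (xs : List A) (f : B → ℕ) → sumOver (map h xs) f ≡ sumOver xs (λ x → f (h x))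
sumOver-map h [] f = refl
sumOver-map h (x ∷ xs) f = cong (f (h x) +_) (sumOver-map h xs f)

sumOver-concatMap : (h : A → List B) (xs : List A) (f : B → ℕ) →
                    sumOver (concatMap h xs) f ≡ sumOver xs (λ x → sumOver (h x) f)
sumOver-concatMap h [] f = refl
sumOver-concatMap h (x ∷ xs) f =
  trans (sumOver-++ (h x) (concatMap h xs) f) (cong (sumOver (h x) f +_) (sumOver-concatMap h xs f))

sumOver-zero : (xs : List A) → sumOver xs (λ _ → 0) ≡ 0
sumOver-zero [] = refl
sumOver-zero (x ∷ xs) = sumOver-zero xs

term≤sumOver : {xs : List A} {x : A} (f : A → ℕ) → x ∈ xs → f x ≤ sumOver xs f
term≤sumOver {xs = y ∷ xs} f (here refl) = m≤m+n (f y) _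
term≤sumOver {xs = y ∷ xs} f (there x∈xs) = ≤-trans (term≤sumOver f x∈xs) (m≤n+m _ (f y))

count-as-sum : (p : A → Bool) (xs : List A) → count p xs ≡ sumOver xs (λ x → 𝟙 (p x))
count-as-sum p [] = refl
count-as-sum p (x ∷ xs) with p x
... | true = cong suc (count-as-sum p xs)
... | false = count-as-sum p xs

count-cong : (xs : List A) {p q : A → Bool} → (∀ x → p x ≡ q x) → count p xs ≡ count q xs
count-cong xs {p} {q} p≗q =
  trans (count-as-sum p xs) (trans (sumOver-cong xs (λ x → cong 𝟙 (p≗q x))) (sym (count-as-sum q xs)))

count-mono : (xs : List A) {p q : A → Bool} → (∀ x → p x ≡ true → q x ≡ true) → count p xs ≤ count q xs
count-mono xs {p} {q} p⇒q = ≤-trans (≤-reflexive (count-as-sum p xs))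
  (≤-trans (sumOver-mono xs (λ x → 𝟙-mono (p x) (q x) (p⇒q x))) (≤-reflexive (sym (count-as-sum q xs))))
  where
  𝟙-mono : ∀ a b → (a ≡ true → b ≡ true) → 𝟙 a ≤ 𝟙 b
  𝟙-mono true b a⇒b rewrite a⇒b refl = ≤-refl
  𝟙-mono false b a⇒b = z≤n

count-split : (xs : List A) (p q : A → Bool) →
              count p xs ≡ count (λ x → p x ∧ q x) xs + count (λ x → p x ∧ not (q x)) xs
count-split xs p q = trans (count-as-sum p xs) (trans (sumOver-cong xs (λ x → 𝟙-split (p x) (q x)))
  (trans (sumOver-+ xs _ _) (sym (cong₂ _+_ (count-as-sum _ xs) (count-as-sum _ xs)))))
  where
  𝟙-split : ∀ a b → 𝟙 a ≡ 𝟙 (a ∧ b) + 𝟙 (a ∧ not b)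
  𝟙-split true true = refl
  𝟙-split true false = refl
  𝟙-split false b = refl

count-∨ : (xs : List A) (p q : A → Bool) → count (λ x → p x ∨ q x) xs ≤ count p xs + count q xs
count-∨ xs p q = ≤-trans (≤-reflexive (count-as-sum _ xs))
  (≤-trans (sumOver-mono xs (λ x → 𝟙-∨ (p x) (q x)))
  (≤-reflexive (trans (sumOver-+ xs _ _) (sym (cong₂ _+_ (count-as-sum p xs) (count-as-sum q xs))))))
  where
  𝟙-∨ : ∀ a b → 𝟙 (a ∨ b) ≤ 𝟙 a + 𝟙 b
  𝟙-∨ true b = s≤s z≤n
  𝟙-∨ false b = ≤-refl

count-none : (xs : List A) {p : A → Bool} → (∀ x → p x ≡ false) → count p xs ≡ 0
count-none [] never = refl
count-none (x ∷ xs) {p} never with p x | never x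
... | false | refl = count-none xs never

count-member : {xs : List A} {x : A} (p : A → Bool) → x ∈ xs → p x ≡ true → 1 ≤ count p xs
count-member {xs = xs} {x = x} p x∈xs px = ≤-trans (≤-reflexive (cong 𝟙 (sym px)))
  (≤-trans (term≤sumOver (λ y → 𝟙 (p y)) x∈xs) (≤-reflexive (sym (count-as-sum p xs))))

count-witness : (xs : List A) (p : A → Bool) → 1 ≤ count p xs → Σ A (λ x → x ∈ xs × p x ≡ true)
count-witness (x ∷ xs) p pos with p x in px
... | true = x , here refl , px
... | false with count-witness xs p pos
...   | y , y∈xs , py = y , there y∈xs , py

⌊⌋-cong : {P Q : Set} → (P → Q) → (Q → P) → (d : Dec P) (e : Dec Q) → ⌊ d ⌋ ≡ ⌊ e ⌋
⌊⌋-cong P⇒Q Q⇒P (yes p) e = sym (⌊⌋-true e (P⇒Q p))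
⌊⌋-cong P⇒Q Q⇒P (no ¬p) e = sym (⌊⌋-false e (λ q → ¬p (Q⇒P q)))

eqF-toℕ : {n : ℕ} (x y : Fin n) → eqF x y ≡ (toℕ x ≡ᵇ toℕ y)
eqF-toℕ x y = trans (⌊⌋-cong (cong toℕ) toℕ-injective (x ≟ y) (toℕ x ℕ.≟ toℕ y))
                    (trans (⌊⌋-map′ _ _ (T? (toℕ x ≡ᵇ toℕ y))) (⌊T?⌋ (toℕ x ≡ᵇ toℕ y)))
  where
  ⌊T?⌋ : ∀ b → ⌊ T? b ⌋ ≡ b
  ⌊T?⌋ true = refl
  ⌊T?⌋ false = refl

eqF-sym : {n : ℕ} (x y : Fin n) → eqF x y ≡ eqF y x
eqF-sym x y = ⌊⌋-cong sym sym (x ≟ y) (y ≟ x)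

<ᵇ-true : {m n : ℕ} → m < n → (m <ᵇ n) ≡ true
<ᵇ-true m<n = Equivalence.to T-≡ (<⇒<ᵇ m<n)

<ᵇ-false : (m n : ℕ) → ¬ m < n → (m <ᵇ n) ≡ false
<ᵇ-false m n m≮n with m <ᵇ n in eq
... | false = refl
... | true = contradiction (<ᵇ⇒< m n (Equivalence.from T-≡ eq)) m≮n

sumBelow : ℕ → (ℕ → ℕ) → ℕ
sumBelow zero f = 0
sumBelow (suc n) f = f 0 + sumBelow n (λ i → f (suc i))

sumBelow-cong : (n : ℕ) {f g : ℕ → ℕ} → (∀ i → f i ≡ g i) → sumBelow n f ≡ sumBelow n g
sumBelow-cong zero f≗g = refl
sumBelow-cong (suc n) f≗g = cong₂ _+_ (f≗g 0) (sumBelow-cong n (λ i → f≗g (suc i)))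

sumBelow-mono : (n : ℕ) {f g : ℕ → ℕ} → (∀ i → f i ≤ g i) → sumBelow n f ≤ sumBelow n g
sumBelow-mono zero f≤g = z≤n
sumBelow-mono (suc n) f≤g = +-mono-≤ (f≤g 0) (sumBelow-mono n (λ i → f≤g (suc i)))

sumBelow-zero : (n : ℕ) → sumBelow n (λ _ → 0) ≡ 0
sumBelow-zero zero = refl
sumBelow-zero (suc n) = sumBelow-zero n

sumBelow-one : (n : ℕ) → sumBelow n (λ _ → 1) ≡ n
sumBelow-one zero = refl
sumBelow-one (suc n) = cong suc (sumBelow-one n)

sumBelow-single : (n u : ℕ) → u < n → sumBelow n (λ k → 𝟙 (u ≡ᵇ k)) ≡ 1
sumBelow-single (suc n) zero _ = cong suc (sumBelow-zero n)
sumBelow-single (suc n) (suc u) (s≤s u<n) = sumBelow-single n u u<n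

sumOver-allFin : (n : ℕ) (F : Fin n → ℕ) (f : ℕ → ℕ) → (∀ i → F i ≡ f (toℕ i)) →
                 sumOver (allFin n) F ≡ sumBelow n f
sumOver-allFin n F f F≗f = go n (λ i → i) F f F≗f
  where
  go : {A : Set} (m : ℕ) (g : Fin m → A) (F : A → ℕ) (f : ℕ → ℕ) → (∀ i → F (g i) ≡ f (toℕ i)) →
       sumOver (tabulate g) F ≡ sumBelow m f
  go zero g F f _ = refl
  go (suc m) g F f h = cong₂ _+_ (h fzero) (go m (λ i → g (fsuc i)) F (λ i → f (suc i)) (λ i → h (fsuc i)))

count-single : (a : Fin n) → count (λ w → eqF w a) (allFin n) ≡ 1
count-single {n} a = begin
  count (λ w → eqF w a) (allFin n)          ≡⟨ count-cong (allFin n) (λ w → eqF-sym w a) ⟩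
  count (eqF a) (allFin n)                  ≡⟨ count-as-sum (eqF a) (allFin n) ⟩
  sumOver (allFin n) (λ w → 𝟙 (eqF a w))    ≡⟨ sumOver-allFin n _ _ (λ w → cong 𝟙 (eqF-toℕ a w)) ⟩
  sumBelow n (λ k → 𝟙 (toℕ a ≡ᵇ k))         ≡⟨ sumBelow-single n (toℕ a) (toℕ<n a) ⟩
  1                                         ∎
  where open ≡-Reasoning

choose2-step : (m : ℕ) → m + m C 2 ≡ suc m C 2
choose2-step m = trans (cong (_+ m C 2) (sym (nC1≡n m))) (nCk+nC[k+1]≡[n+1]C[k+1] m 1)

pairSum : ℕ → (ℕ → ℕ → Bool) → ℕ
pairSum n g = sumBelow n λ j → sumBelow n λ k → 𝟙 ((j <ᵇ k) ∧ g j k)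

tripleSum : ℕ → (ℕ → ℕ → ℕ → Bool) → ℕ
tripleSum n f = sumBelow n λ i → sumBelow n λ j → sumBelow n λ k → 𝟙 ((i <ᵇ j) ∧ ((j <ᵇ k) ∧ f i j k))

count-allTriples : (n : ℕ) (q : Triple n → Bool) (f : ℕ → ℕ → ℕ → Bool) →
  (∀ a b c (a<b : a Fin.< b) (b<c : b Fin.< c) → q (a , b , c , a<b , b<c) ≡ f (toℕ a) (toℕ b) (toℕ c)) →
  count q (allTriples n) ≡ tripleSum n f
count-allTriples n q f q≗f = trans (count-as-sum q (allTriples n))
  (trans (sumOver-concatMap _ (allFin n) _)
    (sumOver-allFin n _ _ λ a → trans (sumOver-concatMap _ (allFin n) _)
      (sumOver-allFin n _ _ λ b → trans (sumOver-concatMap _ (allFin n) _)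
        (sumOver-allFin n _ _ λ c → atIndices a b c))))
  where
  atIndices : ∀ a b c → sumOver (tripleAt a b c) (λ t → 𝟙 (q t)) ≡
              𝟙 ((toℕ a <ᵇ toℕ b) ∧ ((toℕ b <ᵇ toℕ c) ∧ f (toℕ a) (toℕ b) (toℕ c)))
  atIndices a b c with a <? b | b <? c
  ... | yes a<b | yes b<c rewrite <ᵇ-true a<b | <ᵇ-true b<c = trans (+-identityʳ _) (cong 𝟙 (q≗f a b c a<b b<c))
  ... | yes a<b | no b≮c rewrite <ᵇ-true a<b | <ᵇ-false (toℕ b) (toℕ c) b≮c = refl
  ... | no a≮b | _ rewrite <ᵇ-false (toℕ a) (toℕ b) a≮b = refl

-- Peeling off the least index 0 (for pairSum this is definitional; for tripleSum the terms with
-- least index 0 and a middle index 0 vanish).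
tripleSum-step : (m : ℕ) (f : ℕ → ℕ → ℕ → Bool) →
                 tripleSum (suc m) f ≡ pairSum m (λ j k → f 0 (suc j) (suc k))
                                       + tripleSum m (λ i j k → f (suc i) (suc j) (suc k))
tripleSum-step m f = cong₂ _+_ leastIs0 (sumBelow-cong m leastPositive)
  where
  g : ℕ → ℕ → ℕ → Bool
  g i j k = f (suc i) (suc j) (suc k)
  leastIs0 : sumBelow (suc m) (λ _ → 0) + pairSum m (λ j k → f 0 (suc j) (suc k))
             ≡ pairSum m (λ j k → f 0 (suc j) (suc k))
  leastIs0 = cong (_+ pairSum m (λ j k → f 0 (suc j) (suc k))) (sumBelow-zero (suc m))
  leastPositive : ∀ i →
    (sumBelow (suc m) λ j → sumBelow (suc m) λ k → 𝟙 ((suc i <ᵇ j) ∧ ((j <ᵇ k) ∧ f (suc i) j k)))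
    ≡ (sumBelow m λ j → sumBelow m λ k → 𝟙 ((i <ᵇ j) ∧ ((j <ᵇ k) ∧ g i j k)))
  leastPositive i =
    trans (cong (_+ sumBelow m (λ j → sumBelow (suc m) λ k → 𝟙 ((i <ᵇ j) ∧ ((suc j <ᵇ k) ∧ f (suc i) (suc j) k))))
                (sumBelow-zero (suc m)))
          (sumBelow-cong m λ j → cong (λ b → 𝟙 b + sumBelow m (λ k → 𝟙 ((i <ᵇ j) ∧ ((j <ᵇ k) ∧ g i j k))))
                                      (∧-zeroʳ (i <ᵇ j)))

pairSum-none : (n : ℕ) → pairSum n (λ _ _ → false) ≡ 0
pairSum-none n = trans (sumBelow-cong n λ j → trans (sumBelow-cong n λ k → cong 𝟙 (∧-zeroʳ (j <ᵇ k)))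
                                                    (sumBelow-zero n))
                       (sumBelow-zero n)

tripleSum-none : (n : ℕ) → tripleSum n (λ _ _ _ → false) ≡ 0
tripleSum-none n = trans (sumBelow-cong n λ i → trans (sumBelow-cong n λ j → trans (sumBelow-cong n λ k →
                      cong (λ b → 𝟙 ((i <ᵇ j) ∧ b)) (∧-zeroʳ (j <ᵇ k))) (pairRow i j)) (sumBelow-zero n))
                   (sumBelow-zero n)
  where
  pairRow : ∀ i j → sumBelow n (λ k → 𝟙 ((i <ᵇ j) ∧ false)) ≡ 0
  pairRow i j = trans (sumBelow-cong n λ k → cong 𝟙 (∧-zeroʳ (i <ᵇ j))) (sumBelow-zero n)

pairCount : (n : ℕ) → pairSum n (λ _ _ → true) ≡ n C 2
pairCount zero = refl
pairCount (suc n) = trans (cong₂ _+_ (sumBelow-one n) (pairCount n)) (choose2-step n)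

among2 : ℕ → ℕ → ℕ → Bool
among2 u j k = (u ≡ᵇ j) ∨ (u ≡ᵇ k)

among3 : ℕ → ℕ → ℕ → ℕ → Bool
among3 u i j k = (u ≡ᵇ i) ∨ among2 u j k

pairsThrough : (n u : ℕ) → u < n → pairSum n (among2 u) ≡ n ∸ 1
pairsThrough (suc n) zero _ = trans (cong₂ _+_ (sumBelow-one n) (pairSum-none n)) (+-identityʳ n)
pairsThrough (suc (suc n)) (suc u) (s≤s u<n) =
  cong₂ _+_ (sumBelow-single (suc n) u u<n) (pairsThrough (suc n) u u<n)

triplesThrough : (n u : ℕ) → u < n → tripleSum n (among3 u) ≡ (n ∸ 1) C 2
triplesThrough (suc n) zero _ =
  trans (tripleSum-step n (among3 0)) (trans (cong₂ _+_ (pairCount n) (tripleSum-none n)) (+-identityʳ _))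
triplesThrough (suc (suc n)) (suc u) (s≤s u<n) =
  trans (tripleSum-step (suc n) (among3 (suc u)))
        (trans (cong₂ _+_ (pairsThrough (suc n) u u<n) (triplesThrough (suc n) u u<n)) (choose2-step n))

triplePoint : (n a b c : ℕ) → a < n → b < n → c < n →
              tripleSum n (λ i j k → (a ≡ᵇ i) ∧ ((b ≡ᵇ j) ∧ (c ≡ᵇ k))) ≤ 1
triplePoint n a b c a<n b<n c<n = begin
  tripleSum n (λ i j k → (a ≡ᵇ i) ∧ ((b ≡ᵇ j) ∧ (c ≡ᵇ k)))
    ≤⟨ sumBelow-mono n (λ i → sumBelow-mono n λ j → sumBelow-mono n λ k →
         forget-order (i <ᵇ j) (j <ᵇ k) (a ≡ᵇ i) (b ≡ᵇ j) (c ≡ᵇ k)) ⟩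
  (sumBelow n λ i → sumBelow n λ j → sumBelow n λ k → 𝟙 (((a ≡ᵇ i) ∧ (b ≡ᵇ j)) ∧ (c ≡ᵇ k)))
    ≡⟨ sumBelow-cong n (λ i → trans (sumBelow-cong n λ j → pick ((a ≡ᵇ i) ∧ (b ≡ᵇ j)) c<n)
                                    (pick (a ≡ᵇ i) b<n)) ⟩
  sumBelow n (λ i → 𝟙 (a ≡ᵇ i))
    ≡⟨ sumBelow-single n a a<n ⟩
  1 ∎
  where
  open ≤-Reasoning
  forget-order : ∀ x y p q r → 𝟙 (x ∧ (y ∧ (p ∧ (q ∧ r)))) ≤ 𝟙 ((p ∧ q) ∧ r)
  forget-order true true p q r = ≤-reflexive (cong 𝟙 (sym (∧-assoc p q r)))
  forget-order true false p q r = z≤n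
  forget-order false y p q r = z≤n
  pick : ∀ X {m} → m < n → sumBelow n (λ k → 𝟙 (X ∧ (m ≡ᵇ k))) ≡ 𝟙 X
  pick true {m} m<n = sumBelow-single n m m<n
  pick false m<n = sumBelow-zero n

triplesContaining : {n : ℕ} (u : Fin n) → count (inTriple u) (allTriples n) ≡ (n ∸ 1) C 2
triplesContaining {n} u = trans (count-allTriples n (inTriple u) _ λ a b c _ _ →
    cong₂ _∨_ (eqF-toℕ u a) (cong₂ _∨_ (eqF-toℕ u b) (eqF-toℕ u c)))
  (triplesThrough n (toℕ u) (toℕ<n u))

triple-unique : {n : ℕ} (t : Triple n) → count (sameTriple t) (allTriples n) ≤ 1
triple-unique {n} t@(a , b , c , _) =
  ≤-trans (≤-reflexive (count-allTriples n (sameTriple t) _ λ a′ b′ c′ _ _ →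
    cong₂ _∧_ (eqF-toℕ a a′) (cong₂ _∧_ (eqF-toℕ b b′) (eqF-toℕ c c′))))
  (triplePoint n (toℕ a) (toℕ b) (toℕ c) (toℕ<n a) (toℕ<n b) (toℕ<n c))

triple∈allTriples : {n : ℕ} (t : Triple n) → t ∈ allTriples n
triple∈allTriples (a , b , c , a<b , b<c) =
  ∈-concatMap⁺ _ (lose (∈-allFin a)
    (∈-concatMap⁺ _ (lose (∈-allFin b)
      (∈-concatMap⁺ _ (lose (∈-allFin c) atIndices)))))
  where
  atIndices : (a , b , c , a<b , b<c) ∈ tripleAt a b c
  atIndices with a <? b | b <? c
  ... | yes a<b′ | yes b<c′ rewrite <-irrelevant a<b a<b′ | <-irrelevant b<c b<c′ = here refl
  ... | yes _ | no b≮c = contradiction b<c b≮c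
  ... | no a≮b | _ = contradiction a<b a≮b

count-remove : (q : Fin n → Bool) {x : Fin n} → q x ≡ true →
               count q (allFin n) ≡ suc (count (λ w → q w ∧ not (eqF w x)) (allFin n))
count-remove {n} q {x} qx = trans (count-split (allFin n) q (λ w → eqF w x))
  (cong (_+ count (λ w → q w ∧ not (eqF w x)) (allFin n))
        (trans (count-cong (allFin n) onlyX) (count-single x)))
  where
  onlyX : ∀ w → (q w ∧ eqF w x) ≡ eqF w x
  onlyX w with w ≟ x
  ... | yes refl = trans (∧-identityʳ (q w)) qx
  ... | no _ = ∧-zeroʳ (q w)

count-two : (q : Fin n → Bool) → 2 ≤ count q (allFin n) →
            Σ (Fin n) λ y → Σ (Fin n) λ z → q y ≡ true × q z ≡ true × ¬ z ≡ y
count-two {n} q two≤ with count-witness (allFin n) q (≤-trans (s≤s z≤n) two≤)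
... | y , _ , qy with count-witness (allFin n) (λ w → q w ∧ not (eqF w y))
                        (≤-pred (≤-trans two≤ (≤-reflexive (count-remove q qy))))
...   | z , _ , qz≠y = y , z , qy , ∧-conicalˡ (q z) _ qz≠y , λ z≡y →
          not-both (⌊⌋-true (z ≟ y) z≡y) (∧-conicalʳ (q z) _ qz≠y)

Among : A → A → A → A → Set
Among w x y z = w ≡ x ⊎ w ≡ y ⊎ w ≡ z

count≤3-closed : (q : Fin n → Bool) → count q (allFin n) ≤ 3 → {x y z : Fin n} →
                 q x ≡ true → q y ≡ true → q z ≡ true → ¬ y ≡ x → ¬ z ≡ x → ¬ z ≡ y →
                 ∀ w → q w ≡ true → Among w x y z
count≤3-closed {n} q ≤3 {x} {y} {z} qx qy qz y≢x z≢x z≢y w qw with w ≟ x | w ≟ y | w ≟ z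
... | yes w≡x | _ | _ = inj₁ w≡x
... | no _ | yes w≡y | _ = inj₂ (inj₁ w≡y)
... | no _ | no _ | yes w≡z = inj₂ (inj₂ w≡z)
... | no w≢x | no w≢y | no w≢z = ⊥-elim (<-irrefl refl (≤-trans four≤ ≤3))
  where
  without : Fin n → (Fin n → Bool) → Fin n → Bool
  without v r w = r w ∧ not (eqF w v)
  keeps : ∀ {v u} (r : Fin n → Bool) → r u ≡ true → ¬ u ≡ v → without v r u ≡ true
  keeps {v} {u} r ru u≢v rewrite ru | ⌊⌋-false (u ≟ v) u≢v = refl
  q₁ q₂ q₃ : Fin n → Bool
  q₁ = without x q
  q₂ = without y q₁
  q₃ = without z q₂
  four≤ : 4 ≤ count q (allFin n)
  four≤ = ≤-trans (s≤s (s≤s (s≤s (count-member q₃ (∈-allFin w)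
                     (keeps q₂ (keeps q₁ (keeps q qw w≢x) w≢y) w≢z)))))
            (≤-reflexive (sym (trans (count-remove q qx) (cong suc (trans (count-remove q₁ (keeps q qy y≢x))
                           (cong suc (count-remove q₂ (keeps q₁ (keeps q qz z≢x) z≢y))))))))

_∈ₜ_ : Fin n → Triple n → Set
w ∈ₜ (a , b , c , _) = Among w a b c

inTriple-complete : {w : Fin n} (t : Triple n) → w ∈ₜ t → inTriple w t ≡ true
inTriple-complete (a , b , c , _) (inj₁ refl) rewrite ⌊⌋-true (a ≟ a) refl = refl
inTriple-complete (a , b , c , _) (inj₂ (inj₁ refl)) rewrite ⌊⌋-true (b ≟ b) refl = ∨-zeroʳ _
inTriple-complete (a , b , c , _) (inj₂ (inj₂ refl))
  rewrite ⌊⌋-true (c ≟ c) refl | ∨-zeroʳ (eqF c b) = ∨-zeroʳ _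

count-members≤3 : (t : Triple n) → count (λ w → inTriple w t) (allFin n) ≤ 3
count-members≤3 {n} (a , b , c , _) = ≤-trans (count-∨ (allFin n) (λ w → eqF w a) (λ w → eqF w b ∨ eqF w c))
  (+-mono-≤ (≤-reflexive (count-single a))
            (≤-trans (count-∨ (allFin n) (λ w → eqF w b) (λ w → eqF w c))
                     (+-mono-≤ (≤-reflexive (count-single b)) (≤-reflexive (count-single c)))))

triple-≡ : {a b c a′ b′ c′ : Fin n}
           {ab : a Fin.< b} {bc : b Fin.< c} {ab′ : a′ Fin.< b′} {bc′ : b′ Fin.< c′} →
           a ≡ a′ → b ≡ b′ → c ≡ c′ →
           _≡_ {A = Triple n} (a , b , c , ab , bc) (a′ , b′ , c′ , ab′ , bc′)
triple-≡ {ab = ab} {bc} {ab′} {bc′} refl refl refl =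
  cong₂ (λ p q → (_ , _ , _ , p , q)) (Finₚ.<-irrelevant ab ab′) (Finₚ.<-irrelevant bc bc′)

sameTriple-refl : (t : Triple n) → sameTriple t t ≡ true
sameTriple-refl (a , b , c , _)
  rewrite ⌊⌋-true (a ≟ a) refl | ⌊⌋-true (b ≟ b) refl | ⌊⌋-true (c ≟ c) refl = refl

sameTriple-sound : (t s : Triple n) → sameTriple t s ≡ true → t ≡ s
sameTriple-sound (a , b , c , _) (a′ , b′ , c′ , _) h =
  triple-≡ (⌊⌋-sound (a ≟ a′) (∧-conicalˡ _ _ h))
           (⌊⌋-sound (b ≟ b′) (∧-conicalˡ _ _ bc-agree))
           (⌊⌋-sound (c ≟ c′) (∧-conicalʳ (eqF b b′) _ bc-agree))
  where
  bc-agree : (eqF b b′ ∧ eqF c c′) ≡ true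
  bc-agree = ∧-conicalʳ (eqF a a′) _ h

least : (t : Triple n) {w : Fin n} → w ∈ₜ t → proj₁ t Fin.≤ w
least (a , b , c , ab , bc) (inj₁ refl) = Finₚ.≤-refl
least (a , b , c , ab , bc) (inj₂ (inj₁ refl)) = <⇒≤ ab
least (a , b , c , ab , bc) (inj₂ (inj₂ refl)) = <⇒≤ (Finₚ.<-trans ab bc)

greatest : (t : Triple n) {w : Fin n} → w ∈ₜ t → w Fin.≤ proj₁ (proj₂ (proj₂ t))
greatest (a , b , c , ab , bc) (inj₁ refl) = <⇒≤ (Finₚ.<-trans ab bc)
greatest (a , b , c , ab , bc) (inj₂ (inj₁ refl)) = <⇒≤ bc
greatest (a , b , c , ab , bc) (inj₂ (inj₂ refl)) = Finₚ.≤-refl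

triple-ext : (t s : Triple n) → (∀ w → w ∈ₜ t → w ∈ₜ s) → (∀ w → w ∈ₜ s → w ∈ₜ t) → t ≡ s
triple-ext t@(a , b , c , ab , bc) s@(a′ , b′ , c′ , ab′ , bc′) t⊆s s⊆t = triple-≡ a≡a′ b≡b′ c≡c′
  where
  a≡a′ : a ≡ a′
  a≡a′ = Finₚ.≤-antisym (least t (s⊆t a′ (inj₁ refl))) (least s (t⊆s a (inj₁ refl)))
  c≡c′ : c ≡ c′
  c≡c′ = Finₚ.≤-antisym (greatest s (t⊆s c (inj₂ (inj₂ refl))))
                        (greatest t (s⊆t c′ (inj₂ (inj₂ refl))))
  b≡b′ : b ≡ b′
  b≡b′ with t⊆s b (inj₂ (inj₁ refl))
  ... | inj₁ b≡a′ = ⊥-elim (Finₚ.<-irrefl (trans a≡a′ (sym b≡a′)) ab)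
  ... | inj₂ (inj₁ b≡b′) = b≡b′
  ... | inj₂ (inj₂ b≡c′) = ⊥-elim (Finₚ.<-irrefl (trans b≡c′ (sym c≡c′)) bc)

Among-swap₁₂ : {w x y z : A} → Among w y x z → Among w x y z
Among-swap₁₂ (inj₁ e) = inj₂ (inj₁ e)
Among-swap₁₂ (inj₂ (inj₁ e)) = inj₁ e
Among-swap₁₂ (inj₂ (inj₂ e)) = inj₂ (inj₂ e)

Among-swap₂₃ : {w x y z : A} → Among w x z y → Among w x y z
Among-swap₂₃ (inj₁ e) = inj₁ e
Among-swap₂₃ (inj₂ (inj₁ e)) = inj₂ (inj₂ e)
Among-swap₂₃ (inj₂ (inj₂ e)) = inj₂ (inj₁ e)

Among-rotate : {w x y z : A} → Among w y z x → Among w x y z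
Among-rotate (inj₁ e) = inj₂ (inj₁ e)
Among-rotate (inj₂ (inj₁ e)) = inj₂ (inj₂ e)
Among-rotate (inj₂ (inj₂ e)) = inj₁ e

SortedAs : Fin n → Fin n → Fin n → Set
SortedAs {n} x y z = Σ (Triple n) λ t → x ∈ₜ t × (∀ w → w ∈ₜ t → Among w x y z)

insertTriple : {x y z : Fin n} → ¬ y ≡ x → ¬ z ≡ x → y Fin.< z → SortedAs x y z
insertTriple {x = x} {y} {z} y≢x z≢x y<z with Finₚ.<-cmp x y
... | tri< x<y _ _ = (x , y , z , x<y , y<z) , inj₁ refl , λ w w∈t → w∈t
... | tri≈ _ x≡y _ = ⊥-elim (y≢x (sym x≡y))
... | tri> _ _ y<x with Finₚ.<-cmp x z
...   | tri< x<z _ _ = (y , x , z , y<x , x<z) , inj₂ (inj₁ refl) , λ w → Among-swap₁₂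
...   | tri≈ _ x≡z _ = ⊥-elim (z≢x (sym x≡z))
...   | tri> _ _ z<x = (y , z , x , y<z , z<x) , inj₂ (inj₂ refl) , λ w → Among-rotate

sortTriple : {x y z : Fin n} → ¬ y ≡ x → ¬ z ≡ x → ¬ z ≡ y → SortedAs x y z
sortTriple {x = x} {y} {z} y≢x z≢x z≢y with Finₚ.<-cmp y z
... | tri< y<z _ _ = insertTriple y≢x z≢x y<z
... | tri≈ _ y≡z _ = ⊥-elim (z≢y (sym y≡z))
... | tri> _ _ z<y with insertTriple z≢x y≢x z<y
...   | t , x∈t , t⊆xzy = t , x∈t , λ w w∈t → Among-swap₂₃ (t⊆xzy w w∈t)

sameLabel : ℕ → ℕ → Bool
sameLabel m k = ⌊ m ℕ.≟ k ⌋

isError-xor : {n : ℕ} (G : Graph n) (cl : Clustering n) (x y : HVertex n) →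
              isError G cl x y ≡ Hplus G x y xor sameLabel (cl x) (cl y)
isError-xor G cl x y with Hplus G x y | ⌊ cl x ℕ.≟ cl y ⌋
... | true | _ = refl
... | false | _ = refl

module _ {n : ℕ} (G : Graph n) (cl : Clustering n) where

  errorBetween : HVertex n → HVertex n → Bool
  errorBetween v w = not (sameVertex v w) ∧ isError G cl v w

  originalErrors : HVertex n → ℕ
  originalErrors v = count (λ w → errorBetween v (inj₁ w)) (allFin n)

  blockErrors : HVertex n → Triple n → ℕ
  blockErrors v t = count (λ i → errorBetween v (inj₂ (t , i))) (allFin 7)

  errorsAt-split : ∀ v → errorsAt G cl v ≡ originalErrors v + sumOver (allTriples n) (blockErrors v)
  errorsAt-split v = begin
    errorsAt G cl v
      ≡⟨ count-as-sum (errorBetween v) (allHVertices n) ⟩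
    sumOver (map inj₁ (allFin n) ++ blocks) indicator
      ≡⟨ sumOver-++ (map inj₁ (allFin n)) blocks indicator ⟩
    sumOver (map inj₁ (allFin n)) indicator + sumOver blocks indicator
      ≡⟨ cong₂ _+_ (along inj₁ (allFin n))
                   (trans (sumOver-concatMap _ (allTriples n) indicator)
                          (sumOver-cong (allTriples n) λ t → along (λ i → inj₂ (t , i)) (allFin 7))) ⟩
    originalErrors v + sumOver (allTriples n) (blockErrors v)   ∎
    where
    open ≡-Reasoning
    blocks : List (HVertex n)
    blocks = concatMap (λ t → map (λ i → inj₂ (t , i)) (allFin 7)) (allTriples n)
    indicator : HVertex n → ℕ
    indicator w = 𝟙 (errorBetween v w)
    along : (h : A → HVertex n) (xs : List A) → sumOver (map h xs) indicator ≡ count (λ x → errorBetween v (h x)) xs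
    along h xs = trans (sumOver-map h xs indicator) (sym (count-as-sum (λ x → errorBetween v (h x)) xs))

  blockErrors≤errorsAt : ∀ v t → blockErrors v t ≤ errorsAt G cl v
  blockErrors≤errorsAt v t = ≤-trans (term≤sumOver (blockErrors v) (triple∈allTriples t))
    (≤-trans (m≤n+m _ (originalErrors v)) (≤-reflexive (sym (errorsAt-split v))))

  -- If each block C_t lies inside one cluster (labelled L t), an original vertex u sees either
  -- no error or 7 errors towards C_t, according to the edge sign towards t and the labels.
  errorsAt-original : (L : Triple n → ℕ) → (∀ t i → cl (inj₂ (t , i)) ≡ L t) → (u : Fin n) →
    errorsAt G cl (inj₁ u) ≡
    originalErrors (inj₁ u) + 7 * count (λ t → inTriple u t xor sameLabel (cl (inj₁ u)) (L t)) (allTriples n)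
  errorsAt-original L blockLabel u = trans (errorsAt-split (inj₁ u)) (cong (originalErrors (inj₁ u) +_)
    (trans (sumOver-cong (allTriples n) sevenOrNone)
      (trans (sumOver-* (allTriples n) 7 _) (cong (7 *_) (sym (count-as-sum _ (allTriples n)))))))
    where
    constant7 : ∀ b → count (λ _ → b) (allFin 7) ≡ 7 * 𝟙 b
    constant7 true = refl
    constant7 false = refl
    sevenOrNone : ∀ t → blockErrors (inj₁ u) t ≡ 7 * 𝟙 (inTriple u t xor sameLabel (cl (inj₁ u)) (L t))
    sevenOrNone t = trans (count-cong (allFin 7) λ i →
        trans (isError-xor G cl (inj₁ u) (inj₂ (t , i)))
              (cong (λ m → inTriple u t xor sameLabel (cl (inj₁ u)) m) (blockLabel t i)))
      (constant7 (inTriple u t xor sameLabel (cl (inj₁ u)) (L t)))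

sameLabel-sym : (m k : ℕ) → sameLabel m k ≡ sameLabel k m
sameLabel-sym m k = ⌊⌋-cong sym sym (m ℕ.≟ k) (k ℕ.≟ m)

adj-irrefl : {n : ℕ} (G : Graph n) {u w : Fin n} → adj G u w ≡ true → eqF w u ≡ false
adj-irrefl G {u} {w} uw with w ≟ u
... | yes refl = ⊥-elim (not-both uw (cong not (irrefl G u)))
... | no _ = refl

module AroundVertex {n : ℕ} (G : Graph n) (p : Fin n → ℕ) (u : Fin n) where

  sameClass : Fin n → Bool
  sameClass w = sameLabel (p w) (p u)

  classmate : Fin n → Bool
  classmate w = sameClass w ∧ not (eqF w u)

  self : sameClass u ≡ true
  self = ⌊⌋-true (p u ℕ.≟ p u) refl

  class-size : count sameClass (allFin n) ≡ suc (count classmate (allFin n))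
  class-size = count-remove sameClass self

  linkedMates unlinkedMates strayNeighbours : ℕ
  linkedMates = count (λ w → classmate w ∧ adj G u w) (allFin n)
  unlinkedMates = count (λ w → classmate w ∧ not (adj G u w)) (allFin n)
  strayNeighbours = count (λ w → adj G u w ∧ not (sameClass w)) (allFin n)

  degree-split : deg G u ≡ linkedMates + strayNeighbours
  degree-split = trans (count-split (allFin n) (adj G u) sameClass)
    (cong (_+ strayNeighbours) (count-cong (allFin n) λ w → neighbourMate (adj-irrefl G {u} {w})))
    where
    neighbourMate : ∀ {a s e} → (a ≡ true → e ≡ false) → (a ∧ s) ≡ ((s ∧ not e) ∧ a)
    neighbourMate {true} {true} a⇒¬e rewrite a⇒¬e refl = refl
    neighbourMate {true} {false} _ = refl
    neighbourMate {false} {s} _ = sym (∧-zeroʳ (s ∧ _))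

  classmates-split : count classmate (allFin n) ≡ linkedMates + unlinkedMates
  classmates-split = count-split (allFin n) classmate (adj G u)

  originalErrors-split : (cl : Clustering n) → (∀ w → sameLabel (cl (inj₁ u)) (cl (inj₁ w)) ≡ sameClass w) →
                         originalErrors G cl (inj₁ u) ≡ strayNeighbours + unlinkedMates
  originalErrors-split cl sameCluster = trans (count-split (allFin n) err (adj G u))
    (cong₂ _+_ (count-cong (allFin n) λ w → erringNeighbour (adj-irrefl G {u} {w}) (errSpec w))
               (count-cong (allFin n) λ w → erringStranger (errSpec w)))
    where
    err : Fin n → Bool
    err w = errorBetween G cl (inj₁ u) (inj₁ w)
    errSpec : ∀ w → err w ≡ (not (eqF w u) ∧ (adj G u w xor sameClass w))
    errSpec w = cong₂ (λ e x → not e ∧ x) (eqF-sym u w)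
                      (trans (isError-xor G cl (inj₁ u) (inj₁ w)) (cong (adj G u w xor_) (sameCluster w)))
    erringNeighbour : ∀ {a s e x} → (a ≡ true → e ≡ false) → x ≡ (not e ∧ (a xor s)) →
                      (x ∧ a) ≡ (a ∧ not s)
    erringNeighbour {true} {s} {e} a⇒¬e refl rewrite a⇒¬e refl = ∧-identityʳ (not s)
    erringNeighbour {false} {s} {e} _ refl = ∧-zeroʳ _
    erringStranger : ∀ {a s e x} → x ≡ (not e ∧ (a xor s)) → (x ∧ not a) ≡ ((s ∧ not e) ∧ not a)
    erringStranger {true} {s} {e} refl = trans (∧-zeroʳ _) (sym (∧-zeroʳ _))
    erringStranger {false} {s} {e} refl = cong (_∧ true) (∧-comm (not e) s)

-- The counting core of the class argument: if u has at least 4 = A + X neighbours, has M = A + N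
-- classmates (A adjacent, N not), M ≤ 2, and at most 2 errors X + N, then N = 0 and M = 2.
class-arith : ∀ {A X N M} → 4 ≤ A + X → A + N ≡ M → M ≤ 2 → X + N ≤ 2 → N ≡ 0 × M ≡ 2
class-arith {A} {X} {N} {M} 4≤A+X A+N≡M M≤2 X+N≤2 = N≡0 , ≤-antisym M≤2 2≤M
  where
  open ≤-Reasoning
  N+N≤0 : N + N ≤ 0
  N+N≤0 = +-cancelˡ-≤ 4 (N + N) 0 (begin
    4 + (N + N)       ≤⟨ +-monoˡ-≤ (N + N) 4≤A+X ⟩
    (A + X) + (N + N) ≡⟨ interchange A X N N ⟩
    (A + N) + (X + N) ≤⟨ +-mono-≤ (≤-trans (≤-reflexive A+N≡M) M≤2) X+N≤2 ⟩
    4                 ≡⟨ sym (+-identityʳ 4) ⟩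
    4 + 0             ∎)
  N≡0 : N ≡ 0
  N≡0 = n≤0⇒n≡0 (m+n≤o⇒m≤o N N+N≤0)
  2≤M : 2 ≤ M
  2≤M = +-cancelʳ-≤ 2 2 M (begin
    4         ≤⟨ 4≤A+X ⟩
    A + X     ≤⟨ +-monoʳ-≤ A (m+n≤o⇒m≤o X X+N≤2) ⟩
    A + 2     ≡⟨ cong (λ k → k + 2) (trans (sym (+-identityʳ A)) (trans (cong (A +_) (sym N≡0)) A+N≡M)) ⟩
    M + 2     ∎)

choose2-pos : {n : ℕ} → 3 ≤ n → 1 ≤ (n ∸ 1) C 2
choose2-pos {suc zero} (s≤s ())
choose2-pos {suc (suc zero)} (s≤s (s≤s ()))
choose2-pos {suc (suc (suc m))} _ =
  ≤-trans (s≤s z≤n) (≤-trans (m≤m+n (suc m) _) (≤-reflexive (choose2-step (suc m))))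

-- The tolerance 7(C - 1) + 2 of an original vertex lying in C 3-subsets: if A of these blocks share
-- its cluster and E blocks are misplaced (C ≤ A + E), then some block shares it (A ≥ 1) ...
budget-agrees : ∀ {C A E O} → 1 ≤ C → C ≤ A + E → O + 7 * E ≤ 7 * (C ∸ 1) + 2 → 1 ≤ A
budget-agrees {suc D} {zero} {E} {O} _ C≤E bound = ⊥-elim (from-no (7 ℕ.≤? 2) (+-cancelˡ-≤ (7 * D) 7 2 (begin
  7 * D + 7 ≡⟨ +-comm (7 * D) 7 ⟩
  7 + 7 * D ≡⟨ sym (*-suc 7 D) ⟩
  7 * suc D ≤⟨ *-monoʳ-≤ 7 C≤E ⟩
  7 * E     ≤⟨ m≤n+m (7 * E) O ⟩
  O + 7 * E ≤⟨ bound ⟩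
  7 * D + 2 ∎)))
  where open ≤-Reasoning
budget-agrees {A = suc A} _ _ _ = s≤s z≤n

-- ... and if at most one block shares it, at most 2 of its errors are towards original vertices.
budget-bounds-O : ∀ {C A E O} → C ≤ A + E → A ≤ 1 → O + 7 * E ≤ 7 * (C ∸ 1) + 2 → O ≤ 2
budget-bounds-O {C} {A} {E} {O} C≤A+E A≤1 bound = +-cancelʳ-≤ (7 * E) O 2 (begin
  O + 7 * E       ≤⟨ bound ⟩
  7 * (C ∸ 1) + 2 ≤⟨ +-monoˡ-≤ 2 (*-monoʳ-≤ 7 (∸-monoˡ-≤ 1 (≤-trans C≤A+E (+-monoˡ-≤ E A≤1)))) ⟩
  7 * E + 2       ≡⟨ +-comm (7 * E) 2 ⟩
  2 + 7 * E       ∎)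
  where open ≤-Reasoning

module Forward {n : ℕ} (3≤n : 3 ≤ n) (G : Graph n) (reg : IsRegular 4 G)
               (cl : Clustering n) (perfect : IsTPerfect G cl) where

  p : Fin n → ℕ
  p u = cl (inj₁ u)

  blockLabel : Triple n → ℕ
  blockLabel t = cl (inj₂ (t , fzero))

  -- Inside C_t all edges are +, so a vertex of C_t errs towards each block-mate in another
  -- cluster; its tolerance 3 allows at most three of them.
  strangers : Triple n → Fin 7 → Fin 7 → Bool
  strangers t i j = not (sameLabel (cl (inj₂ (t , i))) (cl (inj₂ (t , j))))

  strangers≤3 : ∀ t i → count (strangers t i) (allFin 7) ≤ 3
  strangers≤3 t i = ≤-trans (count-mono (allFin 7) strangerIsError)
                            (≤-trans (blockErrors≤errorsAt G cl (inj₂ (t , i)) t) (perfect (inj₂ (t , i))))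
    where
    strangerIsError : ∀ j → strangers t i j ≡ true → errorBetween G cl (inj₂ (t , i)) (inj₂ (t , j)) ≡ true
    strangerIsError j differ rewrite isError-xor G cl (inj₂ (t , i)) (inj₂ (t , j)) | sameTriple-refl t with i ≟ j
    ... | yes refl = ⊥-elim (not-both (⌊⌋-true (cl (inj₂ (t , i)) ℕ.≟ cl (inj₂ (t , i))) refl) differ)
    ... | no _ = differ

  -- Hence each block lies inside one cluster: otherwise each of its 7 vertices would be a
  -- stranger to vertex i or to vertex 0, giving 7 ≤ 3 + 3.
  blockMonochromatic : ∀ t i → cl (inj₂ (t , i)) ≡ blockLabel t
  blockMonochromatic t i with cl (inj₂ (t , i)) ℕ.≟ blockLabel t
  ... | yes same = same
  ... | no differ = ⊥-elim (from-no (7 ℕ.≤? 6)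
          (≤-trans (count-mono (allFin 7) {λ _ → true} strangerToOne)
          (≤-trans (count-∨ (allFin 7) (strangers t i) (strangers t fzero))
                   (+-mono-≤ (strangers≤3 t i) (strangers≤3 t fzero)))))
    where
    strangerToOne : ∀ j → true ≡ true → (strangers t i j ∨ strangers t fzero j) ≡ true
    strangerToOne j _ with sameLabel (cl (inj₂ (t , i))) (cl (inj₂ (t , j))) in e₁
                         | sameLabel (blockLabel t) (cl (inj₂ (t , j))) in e₂
    ... | false | _ = refl
    ... | true | false = refl
    ... | true | true = ⊥-elim (differ (trans (⌊⌋-sound (_ ℕ.≟ _) e₁) (sym (⌊⌋-sound (_ ℕ.≟ _) e₂))))

  -- Different blocks lie in different clusters: otherwise a vertex of C_t would err towards
  -- all 7 vertices of C_s (− edges inside one cluster).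
  blockLabel-injective : ∀ t s → blockLabel t ≡ blockLabel s → t ≡ s
  blockLabel-injective t s same with sameTriple t s in e
  ... | true = sameTriple-sound t s e
  ... | false = ⊥-elim (from-no (7 ℕ.≤? 3)
          (≤-trans (count-mono (allFin 7) {λ _ → true} joinedIsError)
                   (≤-trans (blockErrors≤errorsAt G cl (inj₂ (t , fzero)) s) (perfect (inj₂ (t , fzero))))))
    where
    joinedIsError : ∀ j → true ≡ true → errorBetween G cl (inj₂ (t , fzero)) (inj₂ (s , j)) ≡ true
    joinedIsError j _ rewrite isError-xor G cl (inj₂ (t , fzero)) (inj₂ (s , j)) | e | blockMonochromatic s j =
      ⌊⌋-true (blockLabel t ℕ.≟ blockLabel s) same

  -- Errors at an original vertex u: the 3-subsets t whose block is misplaced relative to u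
  -- (separated from u although u ∈ t, or joined with u although u ∉ t) cost 7 errors each.
  misplaced : Fin n → ℕ
  misplaced u = count (λ t → inTriple u t xor sameLabel (p u) (blockLabel t)) (allTriples n)

  agreeing : Fin n → ℕ
  agreeing u = count (λ t → inTriple u t ∧ sameLabel (p u) (blockLabel t)) (allTriples n)

  budget : ∀ u → originalErrors G cl (inj₁ u) + 7 * misplaced u ≤ 7 * (((n ∸ 1) C 2) ∸ 1) + 2
  budget u = ≤-trans (≤-reflexive (sym (errorsAt-original G cl blockLabel blockMonochromatic u))) (perfect (inj₁ u))

  through≤ : ∀ u → (n ∸ 1) C 2 ≤ agreeing u + misplaced u
  through≤ u = begin
    (n ∸ 1) C 2                      ≡⟨ sym (triplesContaining u) ⟩
    count (inTriple u) (allTriples n)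
      ≡⟨ count-split (allTriples n) (inTriple u) (λ t → sameLabel (p u) (blockLabel t)) ⟩
    agreeing u + _                   ≤⟨ +-monoʳ-≤ (agreeing u) (count-mono (allTriples n) separatedIsMisplaced) ⟩
    agreeing u + misplaced u         ∎
    where
    open ≤-Reasoning
    separatedIsMisplaced : ∀ t → (inTriple u t ∧ not (sameLabel (p u) (blockLabel t))) ≡ true →
                           (inTriple u t xor sameLabel (p u) (blockLabel t)) ≡ true
    separatedIsMisplaced t h with inTriple u t
    ... | true = h

  ownTriple : ∀ u → Σ (Triple n) λ t → inTriple u t ≡ true × blockLabel t ≡ p u
  ownTriple u with count-witness (allTriples n) (λ t → inTriple u t ∧ sameLabel (p u) (blockLabel t))
                     (budget-agrees {O = originalErrors G cl (inj₁ u)} (choose2-pos 3≤n) (through≤ u) (budget u))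
  ... | t , _ , h = t , ∧-conicalˡ _ _ h , sym (⌊⌋-sound (p u ℕ.≟ blockLabel t) (∧-conicalʳ _ _ h))

  own : Fin n → Triple n
  own u = proj₁ (ownTriple u)

  own-contains : ∀ u → inTriple u (own u) ≡ true
  own-contains u = proj₁ (proj₂ (ownTriple u))

  own-label : ∀ u → blockLabel (own u) ≡ p u
  own-label u = proj₂ (proj₂ (ownTriple u))

  -- It is the only one, blocks having distinct labels; so u has at most 2 original errors.
  agreeing≤1 : ∀ u → agreeing u ≤ 1
  agreeing≤1 u = ≤-trans (count-mono (allTriples n) isOwn) (triple-unique (own u))
    where
    isOwn : ∀ t → (inTriple u t ∧ sameLabel (p u) (blockLabel t)) ≡ true → sameTriple (own u) t ≡ true
    isOwn t h = subst (λ s → sameTriple (own u) s ≡ true)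
      (blockLabel-injective (own u) t (trans (own-label u) (⌊⌋-sound (_ ℕ.≟ _) (∧-conicalʳ _ _ h))))
      (sameTriple-refl (own u))

  originalErrors≤2 : ∀ u → originalErrors G cl (inj₁ u) ≤ 2
  originalErrors≤2 u = budget-bounds-O (through≤ u) (agreeing≤1 u) (budget u)

  -- The class of u lies in its own triple: a classmate w has own w ≡ own u, as both blocks carry
  -- the label p w ≡ p u.
  class⊆own : ∀ u w → sameLabel (p w) (p u) ≡ true → inTriple w (own u) ≡ true
  class⊆own u w same = subst (λ t → inTriple w t ≡ true)
    (blockLabel-injective (own w) (own u)
      (trans (own-label w) (trans (⌊⌋-sound (p w ℕ.≟ p u) same) (sym (own-label u)))))
    (own-contains w)

  -- Around u: at most 2 classmates and at most 2 errors, against degree 4, force exactly two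
  -- classmates, both adjacent to u.
  module _ (u : Fin n) where
    open AroundVertex G p u

    classmates≤2 : count classmate (allFin n) ≤ 2
    classmates≤2 = ≤-pred (begin
      suc (count classmate (allFin n))     ≡⟨ sym class-size ⟩
      count sameClass (allFin n)           ≤⟨ count-mono (allFin n) (class⊆own u) ⟩
      count (λ w → inTriple w (own u)) (allFin n) ≤⟨ count-members≤3 (own u) ⟩
      3                                    ∎)
      where open ≤-Reasoning

    classStructure : unlinkedMates ≡ 0 × count classmate (allFin n) ≡ 2
    classStructure = class-arith (≤-reflexive (trans (sym (reg u)) degree-split)) (sym classmates-split) classmates≤2
      (≤-trans (≤-reflexive (sym (originalErrors-split cl (λ w → sameLabel-sym (p u) (p w)))))
               (originalErrors≤2 u))

  trianglePartition : HasTrianglePartition G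
  trianglePartition = p , classSize , classAdjacent
    where
    classSize : ∀ v → count (λ w → sameLabel (p w) (p v)) (allFin n) ≡ 3
    classSize v = trans (AroundVertex.class-size G p v) (cong suc (proj₂ (classStructure v)))
    classAdjacent : ∀ v w → p v ≡ p w → ¬ v ≡ w → adj G v w ≡ true
    classAdjacent v w pv≡pw v≢w with adj G v w in e
    ... | true = refl
    ... | false = ⊥-elim (from-no (1 ℕ.≤? 0) (≤-trans
            (count-member (λ x → AroundVertex.classmate G p v x ∧ not (adj G v x)) (∈-allFin w) unlinked)
            (≤-reflexive (proj₁ (classStructure v)))))
      where
      unlinked : (AroundVertex.classmate G p v w ∧ not (adj G v w)) ≡ true
      unlinked rewrite ⌊⌋-true (p w ℕ.≟ p v) (sym pv≡pw) | ⌊⌋-false (w ≟ v) (λ w≡v → v≢w (sym w≡v)) | e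
        = refl

module Backward {n : ℕ} (G : Graph n) (reg : IsRegular 4 G) (p : Fin n → ℕ)
                (classSize : ∀ v → count (λ w → sameLabel (p w) (p v)) (allFin n) ≡ 3)
                (classAdjacent : ∀ v w → p v ≡ p w → ¬ v ≡ w → adj G v w ≡ true) where

  isClass : Triple n → Bool
  isClass (a , b , c , _) = sameLabel (p a) (p b) ∧ sameLabel (p b) (p c)

  classLabel : (t : Triple n) → isClass t ≡ true → ∀ w → w ∈ₜ t → p w ≡ p (proj₁ t)
  classLabel (a , b , c , _) h w (inj₁ refl) = refl
  classLabel (a , b , c , _) h w (inj₂ (inj₁ refl)) = sym (⌊⌋-sound (p a ℕ.≟ p b) (∧-conicalˡ _ _ h))
  classLabel (a , b , c , _) h w (inj₂ (inj₂ refl)) =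
    sym (trans (⌊⌋-sound (p a ℕ.≟ p b) (∧-conicalˡ _ _ h))
               (⌊⌋-sound (p b ℕ.≟ p c) (∧-conicalʳ _ _ h)))

  isClass-intro : (t : Triple n) (m : ℕ) → (∀ w → w ∈ₜ t → p w ≡ m) → isClass t ≡ true
  isClass-intro (a , b , c , _) m label
    rewrite ⌊⌋-true (p a ℕ.≟ p b) (trans (label a (inj₁ refl)) (sym (label b (inj₂ (inj₁ refl)))))
          | ⌊⌋-true (p b ℕ.≟ p c) (trans (label b (inj₂ (inj₁ refl))) (sym (label c (inj₂ (inj₂ refl)))))
          = refl

  -- A class triple is a whole class, since classes have exactly three members.
  classClosed : (t : Triple n) → isClass t ≡ true → ∀ w → p w ≡ p (proj₁ t) → w ∈ₜ t
  classClosed t@(a , b , c , a<b , b<c) h w pw =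
    count≤3-closed (λ v → sameLabel (p v) (p a)) (≤-reflexive (classSize a)) (inClass a (inj₁ refl))
      (inClass b (inj₂ (inj₁ refl))) (inClass c (inj₂ (inj₂ refl)))
      (λ b≡a → Finₚ.<-irrefl (sym b≡a) a<b) (λ c≡a → Finₚ.<-irrefl (sym c≡a) (Finₚ.<-trans a<b b<c))
      (λ c≡b → Finₚ.<-irrefl (sym c≡b) b<c) w (⌊⌋-true (p w ℕ.≟ p a) pw)
    where
    inClass : ∀ v → v ∈ₜ t → sameLabel (p v) (p a) ≡ true
    inClass v v∈t = ⌊⌋-true (p v ℕ.≟ p a) (classLabel t h v v∈t)

  -- Class blocks join their class (even label 2p); every other block gets a private odd label.
  code : Triple n → ℕ
  code (a , b , c , _) = toℕ (combine a (combine b c))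

  blockLabel : Triple n → ℕ
  blockLabel t = if isClass t then 2 * p (proj₁ t) else suc (2 * code t)

  cl : Clustering n
  cl (inj₁ u) = 2 * p u
  cl (inj₂ (t , _)) = blockLabel t

  classBlockLabel : ∀ t → isClass t ≡ true → blockLabel t ≡ 2 * p (proj₁ t)
  classBlockLabel t class rewrite class = refl

  evenLabel : ∀ t {m} → blockLabel t ≡ 2 * m → isClass t ≡ true × p (proj₁ t) ≡ m
  evenLabel t {m} e with isClass t
  ... | true = refl , *-cancelˡ-≡ (p (proj₁ t)) m 2 e
  ... | false = ⊥-elim (even≢odd m (code t) (sym e))

  sharesWith : ∀ t w → blockLabel t ≡ 2 * p w → w ∈ₜ t
  sharesWith t w e with evenLabel t e
  ... | class , pa≡pw = classClosed t class w (sym pa≡pw)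

  blockLabel-injective : ∀ t s → blockLabel t ≡ blockLabel s → t ≡ s
  blockLabel-injective t s e with isClass t in ct | isClass s in cs
  ... | true | true = triple-ext t s
        (λ w w∈t → classClosed s cs w (trans (classLabel t ct w w∈t) pa≡pa′))
        (λ w w∈s → classClosed t ct w (trans (classLabel s cs w w∈s) (sym pa≡pa′)))
    where
    pa≡pa′ : p (proj₁ t) ≡ p (proj₁ s)
    pa≡pa′ = *-cancelˡ-≡ (p (proj₁ t)) (p (proj₁ s)) 2 e
  ... | true | false = ⊥-elim (even≢odd (p (proj₁ t)) (code s) e)
  ... | false | true = ⊥-elim (even≢odd (p (proj₁ s)) (code t) (sym e))
  ... | false | false = codeInjective t s (*-cancelˡ-≡ (code t) (code s) 2 (suc-injective e))
    where
    codeInjective : ∀ t s → code t ≡ code s → t ≡ s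
    codeInjective (a , b , c , _) (a′ , b′ , c′ , _) e
      with a≡a′ , bc≡bc′ ← combine-injective a (combine b c) a′ (combine b′ c′) (toℕ-injective e)
      with b≡b′ , c≡c′ ← combine-injective b c b′ c′ bc≡bc′ = triple-≡ a≡a′ b≡b′ c≡c′

  -- A block vertex errs only towards original vertices of its own 3-subset.
  blockVertexPerfect : ∀ t i → errorsAt G cl (inj₂ (t , i)) ≤ 3
  blockVertexPerfect t i = begin
    errorsAt G cl x                                                     ≡⟨ errorsAt-split G cl x ⟩
    originalErrors G cl x + sumOver (allTriples n) (blockErrors G cl x)
      ≡⟨ cong (originalErrors G cl x +_)
              (trans (sumOver-cong (allTriples n) noBlockErrors) (sumOver-zero (allTriples n))) ⟩
    originalErrors G cl x + 0                                           ≡⟨ +-identityʳ _ ⟩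
    originalErrors G cl x                                               ≤⟨ count-mono (allFin n) errorInside ⟩
    count (λ w → inTriple w t) (allFin n)                               ≤⟨ count-members≤3 t ⟩
    3                                                                   ∎
    where
    open ≤-Reasoning
    x : HVertex n
    x = inj₂ (t , i)
    signAgrees : ∀ s → (sameTriple t s xor sameLabel (blockLabel t) (blockLabel s)) ≡ false
    signAgrees s with sameTriple t s in e
    ... | true rewrite sameTriple-sound t s e = cong not (⌊⌋-true (blockLabel s ℕ.≟ blockLabel s) refl)
    ... | false = ⌊⌋-false (blockLabel t ℕ.≟ blockLabel s) λ same →
            not-both (trans (cong (sameTriple t) (sym (blockLabel-injective t s same))) (sameTriple-refl t))
                     (cong not e)
    noBlockErrors : ∀ s → blockErrors G cl x s ≡ 0
    noBlockErrors s = count-none (allFin 7) λ j →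
      trans (cong (not (sameTriple t s ∧ eqF i j) ∧_) (trans (isError-xor G cl x (inj₂ (s , j))) (signAgrees s)))
            (∧-zeroʳ _)
    errorInside : ∀ w → errorBetween G cl x (inj₁ w) ≡ true → inTriple w t ≡ true
    errorInside w h = insideOf (trans (sym (isError-xor G cl x (inj₁ w))) h)
      where
      insideOf : (inTriple w t xor sameLabel (blockLabel t) (2 * p w)) ≡ true → inTriple w t ≡ true
      insideOf err with inTriple w t in e
      ... | true = refl
      ... | false = ⊥-elim (not-both (inTriple-complete t (sharesWith t w (⌊⌋-sound (_ ℕ.≟ _) err))) (cong not e))

  module _ (u : Fin n) where
    open AroundVertex G p u

    sameCluster : ∀ w → sameLabel (cl (inj₁ u)) (cl (inj₁ w)) ≡ sameClass w
    sameCluster w = trans (⌊⌋-cong (*-cancelˡ-≡ (p u) (p w) 2) (cong (2 *_))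
                                   (2 * p u ℕ.≟ 2 * p w) (p u ℕ.≟ p w))
                          (sameLabel-sym (p u) (p w))

    twoClassmates : count classmate (allFin n) ≡ 2
    twoClassmates = suc-injective (trans (sym class-size) (classSize u))

    classmate-sound : ∀ {w} → classmate w ≡ true → p w ≡ p u × ¬ w ≡ u
    classmate-sound {w} h = ⌊⌋-sound (p w ℕ.≟ p u) (∧-conicalˡ _ _ h) ,
                            λ w≡u → not-both (⌊⌋-true (w ≟ u) w≡u) (∧-conicalʳ _ _ h)

    -- Classmates are adjacent, so the only errors at u towards original vertices are its two
    -- neighbours outside the triangle.
    noUnlinkedMates : unlinkedMates ≡ 0
    noUnlinkedMates = count-none (allFin n) linked
      where
      linked : ∀ w → (classmate w ∧ not (adj G u w)) ≡ false
      linked w with classmate w in e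
      ... | false = refl
      ... | true = cong not (classAdjacent u w (sym (proj₁ (classmate-sound e)))
                                                 (λ u≡w → proj₂ (classmate-sound e) (sym u≡w)))

    strayNeighbours≡2 : strayNeighbours ≡ 2
    strayNeighbours≡2 = +-cancelˡ-≡ 2 strayNeighbours 2
      (trans (cong (_+ strayNeighbours) linkedMates≡2) (trans (sym degree-split) (reg u)))
      where
      linkedMates≡2 : 2 ≡ linkedMates
      linkedMates≡2 = trans (sym twoClassmates) (trans classmates-split
                        (trans (cong (linkedMates +_) noUnlinkedMates) (+-identityʳ linkedMates)))

    originalErrors≡2 : originalErrors G cl (inj₁ u) ≡ 2
    originalErrors≡2 = trans (originalErrors-split cl sameCluster) (cong₂ _+_ strayNeighbours≡2 noUnlinkedMates)

    ownTriple : Σ (Triple n) λ t → u ∈ₜ t × blockLabel t ≡ 2 * p u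
    ownTriple = fromMates (count-two classmate (≤-reflexive (sym twoClassmates)))
      where
      fromMates : (Σ (Fin n) λ y → Σ (Fin n) λ z → classmate y ≡ true × classmate z ≡ true × ¬ z ≡ y) →
                  Σ (Triple n) λ t → u ∈ₜ t × blockLabel t ≡ 2 * p u
      fromMates (y , z , cy , cz , z≢y) =
        fromSorted (sortTriple (proj₂ (classmate-sound cy)) (proj₂ (classmate-sound cz)) z≢y)
        where
        inClass : ∀ {w} → Among w u y z → p w ≡ p u
        inClass (inj₁ refl) = refl
        inClass (inj₂ (inj₁ refl)) = proj₁ (classmate-sound cy)
        inClass (inj₂ (inj₂ refl)) = proj₁ (classmate-sound cz)
        fromSorted : SortedAs u y z → Σ (Triple n) λ t → u ∈ₜ t × blockLabel t ≡ 2 * p u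
        fromSorted (t , u∈t , t⊆uyz) = t , u∈t ,
          trans (classBlockLabel t (isClass-intro t (p u) λ w w∈t → inClass (t⊆uyz w w∈t)))
                (cong (2 *_) (inClass (t⊆uyz (proj₁ t) (inj₁ refl))))

    -- Each 3-subset through u other than its triangle costs 7 errors; no other block does.
    misplaced : ℕ
    misplaced = count (λ t → inTriple u t xor sameLabel (2 * p u) (blockLabel t)) (allTriples n)

    misplaced≤ : (own : Triple n) → u ∈ₜ own → blockLabel own ≡ 2 * p u → misplaced ≤ ((n ∸ 1) C 2) ∸ 1
    misplaced≤ own u∈own ownLabel = ≤-trans (count-mono (allTriples n) otherTriple)
      (all-but-one (count-member (λ t → inTriple u t ∧ sameTriple own t) (triple∈allTriples own) ownCounted)
                   (trans (sym (triplesContaining u)) (count-split (allTriples n) (inTriple u) (sameTriple own))))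
      where
      all-but-one : ∀ {A X C} → 1 ≤ A → C ≡ A + X → X ≤ C ∸ 1
      all-but-one {suc A} {X} _ refl = m≤n+m X A
      ownCounted : (inTriple u own ∧ sameTriple own own) ≡ true
      ownCounted = ∧-intro (inTriple-complete own u∈own) (sameTriple-refl own)
      otherTriple : ∀ t → (inTriple u t xor sameLabel (2 * p u) (blockLabel t)) ≡ true →
                    (inTriple u t ∧ not (sameTriple own t)) ≡ true
      otherTriple t err with xor-cases err
      ... | inj₁ (u∈t , separated) = ∧-intro u∈t (not-intro λ same →
              not-both (⌊⌋-true (2 * p u ℕ.≟ blockLabel t)
                                (sym (trans (cong blockLabel (sym (sameTriple-sound own t same))) ownLabel)))
                       (cong not separated))
      ... | inj₂ (u∉t , joined) = ⊥-elim
              (not-both (inTriple-complete t (sharesWith t u (sym (⌊⌋-sound (_ ℕ.≟ _) joined)))) (cong not u∉t))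

    originalVertexPerfect : errorsAt G cl (inj₁ u) ≤ tolerance {n} (inj₁ u)
    originalVertexPerfect = begin
      errorsAt G cl (inj₁ u)                       ≡⟨ errorsAt-original G cl blockLabel (λ t i → refl) u ⟩
      originalErrors G cl (inj₁ u) + 7 * misplaced
        ≤⟨ +-mono-≤ (≤-reflexive originalErrors≡2) (*-monoʳ-≤ 7 (misplaced≤ own u∈own ownLabel)) ⟩
      2 + 7 * (((n ∸ 1) C 2) ∸ 1)                  ≡⟨ +-comm 2 (7 * (((n ∸ 1) C 2) ∸ 1)) ⟩
      7 * (((n ∸ 1) C 2) ∸ 1) + 2                  ∎
      where
      open ≤-Reasoning
      own : Triple n
      own = proj₁ ownTriple
      u∈own : u ∈ₜ own
      u∈own = proj₁ (proj₂ ownTriple)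
      ownLabel : blockLabel own ≡ 2 * p u
      ownLabel = proj₂ (proj₂ ownTriple)

  perfectClustering : HasTPerfectClustering G
  perfectClustering = cl , perfect
    where
    perfect : IsTPerfect G cl
    perfect (inj₁ u) = originalVertexPerfect u
    perfect (inj₂ (t , i)) = blockVertexPerfect t i

corollary1 : (n : ℕ) → 7 ≤ n → (G : Graph n) → IsRegular 4 G →
    HasTPerfectClustering G ⇔ HasTrianglePartition G
corollary1 n 7≤n G reg = mk⇔
  (λ (cl , perfect) → Forward.trianglePartition (≤-trans (from-yes (3 ℕ.≤? 7)) 7≤n) G reg cl perfect)
  (λ (p , classSize , classAdjacent) → Backward.perfectClustering G reg p classSize classAdjacent)
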